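{- Let $k>t$ be positive integers. Then there exist infinitely many positive integers $d$ such that $t$ divides $dk$ and the following holds: if $X$ is a set of size $dk/t$, then there exists a family $\mathcal{A}=\{A_1,\ldots,A_k\}$ of $k$ subsets of $X$, each of size $d$, such that each element of $X$ is contained in exactly $t$ of the sets $A_1,\ldots,A_k$, and for every $2\le r\le t$ and every $1\le i_1<i_2<\cdots<i_r\le k$, $$|A_{i_1}\cap A_{i_2}\cap\cdots\cap A_{i_r}| = d\,\frac{(t-1)(t-2)\cdots(t-r+1)}{(k-1)(k-2)\cdots(k-r+1)}.$$ -}

module Defs where

open import Data.Nat using (ℕ)
open import Data.Fin using (Fin)
open import Data.Fin.Subset using (Subset; ⋂)
open import Data.Fin.Subset.Properties using (_∈?_)
open import Data.Vec using (tabulate)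
open import Data.List as List using (List)
open import Relation.Nullary using (does)

Family : ℕ → ℕ → Set
Family k m = Fin k → Subset m

indicesContaining : ∀ {k m} → Family k m → Fin m → Subset k
indicesContaining A x = tabulate (λ i → does (x ∈? A i))

interOf : ∀ {k m r} → Family k m → (Fin r → Fin k) → Subset m
interOf {r = r} A i = ⋂ (List.tabulate {n = r} (λ j → A (i j)))

-- Take as points the t-subsets of {1,…,k} and let A_i be the set of points containing i. Then
-- |A_i| = C(k-1,t-1), every point lies in exactly t of the sets, and r distinct sets meet in the
-- C(k-r,t-r) points containing all r indices; the double-counting identity
-- C(k-r,t-r)·(k-1)!/(k-r)! = C(k-1,t-1)·(t-1)!/(t-r)! is the required intersection formula.
-- Taking c copies of every point multiplies all sizes by c, so d = c·C(k-1,t-1) works for every c ≥ 1.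

module Submission where

open import Defs
open import Data.Nat using (ℕ; zero; suc; _+_; _*_; _∸_; _≤_; _<_; z≤n; s≤s; z<s; s<s⁻¹; _≤ᵇ_; >-nonZero)
open import Data.Nat.Properties
open import Data.Nat.Tactic.RingSolver using (solve-∀)
open import Data.Nat.Divisibility using (_∣_; divides)
open import Data.Nat.Combinatorics using (_P_)
open import Data.Nat.Combinatorics.Base using (_P′_)
open import Data.Fin using (Fin; zero; suc; _↑ˡ_; _↑ʳ_; join; splitAt; punchOut) renaming (_<_ to _<ᶠ_)
open import Data.Fin.Properties using (join-splitAt; injective⇒≤; punchIn-punchOut) renaming (<-cmp to <ᶠ-cmp; <⇒≢ to <ᶠ⇒≢)
open import Data.Fin.Subset using (Subset; ⊥; ⊤; _∩_; ⋂; ∣_∣; inside; outside)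
open import Data.Fin.Subset.Properties using (_∈?_; ∉⊥; ∈⊤; ∣⊤∣≡n; ∣p∣≤n; ∩-zeroˡ; ∩-identityˡ; ∩-identityʳ)
open import Data.Vec using ([]; _∷_; _++_; tabulate)
open import Data.Vec.Properties using (zipWith-++; tabulate-cong)
open import Data.Vec.Functional using () renaming (_∷_ to _∷ᶠ_)
import Data.List.Properties as List
open import Data.Bool using (true; _∧_)
open import Data.Product using (Σ; Σ-syntax; ∃; _×_; _,_)
open import Data.Sum using (_⊎_; inj₁; inj₂; [_,_])
open import Function using (_∘_)
open import Function.Definitions using (Injective)
open import Relation.Binary using (tri<; tri≈; tri>)
open import Relation.Nullary using (does; contradiction)
open import Relation.Nullary.Decidable using (dec-true; dec-false)
open import Relation.Binary.PropositionalEquality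
open ≡-Reasoning

-- Pascal's recursion rather than the library's _C_, so that the ground set of incidence below has
-- size binomial n k by computation.
binomial : ℕ → ℕ → ℕ
binomial n       zero    = 1
binomial zero    (suc k) = 0
binomial (suc n) (suc k) = binomial n (suc k) + binomial n k

binomial[n,1]≡n : ∀ n → binomial n 1 ≡ n
binomial[n,1]≡n zero    = refl
binomial[n,1]≡n (suc n) = trans (cong (_+ 1) (binomial[n,1]≡n n)) (+-comm n 1)

k≤n⇒binomial>0 : ∀ {n k} → k ≤ n → 0 < binomial n k
k≤n⇒binomial>0 {k = zero}          _         = s≤s z≤n
k≤n⇒binomial>0 {suc n} {suc k} (s≤s k≤n) = ≤-trans (k≤n⇒binomial>0 k≤n) (m≤n+m _ _)

binomial-absorption : ∀ n k → binomial (suc n) (suc k) * suc k ≡ suc n * binomial n k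
binomial-absorption zero    zero    = refl
binomial-absorption zero    (suc k) = *-zeroˡ (2 + k)
binomial-absorption (suc n) zero    =
  trans (*-identityʳ _) (trans (binomial[n,1]≡n (2 + n)) (sym (*-identityʳ (2 + n))))
binomial-absorption (suc n) (suc k) = begin
  (X + Y) * (2 + k)                    ≡⟨ expand X Y k ⟩
  X * (2 + k) + (Y + Y * (1 + k))
    ≡⟨ cong₂ (λ u v → u + (Y + v)) (binomial-absorption n (suc k)) (binomial-absorption n k) ⟩
  (1 + n) * U + (Y + (1 + n) * V)      ≡⟨ collect n U V Y ⟩
  Y + (1 + n) * (U + V)                ∎
  where
  X = binomial (suc n) (2 + k)
  Y = binomial (suc n) (suc k)
  U = binomial n (suc k)
  V = binomial n k
  expand : ∀ x y k → (x + y) * (2 + k) ≡ x * (2 + k) + (y + y * (1 + k))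
  expand = solve-∀
  collect : ∀ n u v y → (1 + n) * u + (y + (1 + n) * v) ≡ y + (1 + n) * (u + v)
  collect = solve-∀

P≡P′ : ∀ {n k} → k ≤ n → n P k ≡ n P′ k
P≡P′ {n} {k} k≤n with k ≤ᵇ n | ≤⇒≤ᵇ k≤n
... | true | _ = refl

-- supersets n k r is the number of k-subsets of an n-set containing a fixed r-subset, i.e. C(n-r, k-r).
supersets : ℕ → ℕ → ℕ → ℕ
supersets n       k       zero    = binomial n k
supersets zero    k       (suc r) = 0
supersets (suc n) zero    (suc r) = 0
supersets (suc n) (suc k) (suc r) = supersets n k r

supersets-pascal : ∀ n k r → r ≤ n → supersets n (suc k) r + supersets n k r ≡ supersets (suc n) (suc k) r
supersets-pascal n             k       zero          _         = refl
supersets-pascal (suc n)       zero    (suc zero)    _         = +-identityʳ _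
supersets-pascal (suc zero)    zero    (suc (suc r)) _         = refl
supersets-pascal (suc (suc n)) zero    (suc (suc r)) _         = refl
supersets-pascal (suc n)       (suc k) (suc r)       (s≤s r≤n) = supersets-pascal n k r r≤n

supersets-suc : ∀ n k r → r < k → k ≤ n → supersets n k (suc r) * (n ∸ r) ≡ supersets n k r * (k ∸ r)
supersets-suc (suc n) (suc k) zero    _         _         =
  trans (*-comm (binomial n k) (suc n)) (sym (binomial-absorption n k))
supersets-suc (suc n) (suc k) (suc r) (s≤s r<k) (s≤s k≤n) = supersets-suc n k r r<k k≤n

supersets*P′ : ∀ n k r → r ≤ k → k ≤ n → supersets n k r * (n P′ r) ≡ binomial n k * (k P′ r)
supersets*P′ n k zero    _   _   = refl
supersets*P′ n k (suc r) r<k k≤n = begin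
  S (suc r) * ((n ∸ r) * (n P′ r))   ≡⟨ *-assoc (S (suc r)) (n ∸ r) (n P′ r) ⟨
  S (suc r) * (n ∸ r) * (n P′ r)     ≡⟨ cong (_* (n P′ r)) (supersets-suc n k r r<k k≤n) ⟩
  S r * (k ∸ r) * (n P′ r)           ≡⟨ x*y*z≡x*z*y (S r) (k ∸ r) (n P′ r) ⟩
  S r * (n P′ r) * (k ∸ r)           ≡⟨ cong (_* (k ∸ r)) (supersets*P′ n k r (<⇒≤ r<k) k≤n) ⟩
  binomial n k * (k P′ r) * (k ∸ r)  ≡⟨ x*y*z≡x*[z*y] (binomial n k) (k P′ r) (k ∸ r) ⟩
  binomial n k * ((k ∸ r) * (k P′ r))  ∎
  where
  S = supersets n k
  x*y*z≡x*z*y : ∀ x y z → x * y * z ≡ x * z * y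
  x*y*z≡x*z*y = solve-∀
  x*y*z≡x*[z*y] : ∀ x y z → x * y * z ≡ x * (z * y)
  x*y*z≡x*[z*y] = solve-∀

∣p++q∣≡∣p∣+∣q∣ : ∀ {m n} (p : Subset m) (q : Subset n) → ∣ p ++ q ∣ ≡ ∣ p ∣ + ∣ q ∣
∣p++q∣≡∣p∣+∣q∣ []            q = refl
∣p++q∣≡∣p∣+∣q∣ (inside  ∷ p) q = cong suc (∣p++q∣≡∣p∣+∣q∣ p q)
∣p++q∣≡∣p∣+∣q∣ (outside ∷ p) q = ∣p++q∣≡∣p∣+∣q∣ p q

⊤++⊤≡⊤ : ∀ m n → ⊤ {m} ++ ⊤ {n} ≡ ⊤
⊤++⊤≡⊤ zero    n = refl
⊤++⊤≡⊤ (suc m) n = cong (inside ∷_) (⊤++⊤≡⊤ m n)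

∣[⊥++⊤]∩[p++q]∣≡∣q∣ : ∀ {m n} (p : Subset m) (q : Subset n) → ∣ (⊥ {m} ++ ⊤ {n}) ∩ (p ++ q) ∣ ≡ ∣ q ∣
∣[⊥++⊤]∩[p++q]∣≡∣q∣ []      q = cong ∣_∣ (∩-identityˡ q)
∣[⊥++⊤]∩[p++q]∣≡∣q∣ (_ ∷ p) q = ∣[⊥++⊤]∩[p++q]∣≡∣q∣ p q

∣tabulate-outside∣ : ∀ n → ∣ tabulate {n = n} (λ _ → outside) ∣ ≡ 0
∣tabulate-outside∣ zero    = refl
∣tabulate-outside∣ (suc n) = ∣tabulate-outside∣ n

∈?-++ˡ : ∀ {m n} (p : Subset m) (q : Subset n) x → does (x ↑ˡ n ∈? p ++ q) ≡ does (x ∈? p)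
∈?-++ˡ (inside  ∷ p) q zero    = refl
∈?-++ˡ (outside ∷ p) q zero    = refl
∈?-++ˡ (_       ∷ p) q (suc x) = ∈?-++ˡ p q x

∈?-++ʳ : ∀ {m n} (p : Subset m) (q : Subset n) x → does (m ↑ʳ x ∈? p ++ q) ≡ does (x ∈? q)
∈?-++ʳ []      q x = refl
∈?-++ʳ (_ ∷ p) q x = ∈?-++ʳ p q x

↑-elim : ∀ {m n} {Q : Fin (m + n) → Set} → (∀ x → Q (x ↑ˡ n)) → (∀ x → Q (m ↑ʳ x)) → ∀ x → Q x
↑-elim {m} {n} {Q} left right x =
  subst Q (join-splitAt m n x) ([_,_] {C = Q ∘ join m n} left right (splitAt m x))

infixr 5 _⊕_
_⊕_ : ∀ {k m n} → Family k m → Family k n → Family k (m + n)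
(A ⊕ B) i = A i ++ B i

copies : ∀ {k m} (c : ℕ) → Family k m → Family k (c * m)
copies zero    A = λ _ → []
copies (suc c) A = A ⊕ copies c A

∣copies∣ : ∀ {k m} c (A : Family k m) i → ∣ copies c A i ∣ ≡ c * ∣ A i ∣
∣copies∣ zero    A i = refl
∣copies∣ (suc c) A i = trans (∣p++q∣≡∣p∣+∣q∣ (A i) (copies c A i)) (cong (∣ A i ∣ +_) (∣copies∣ c A i))

Regular : ∀ {k m} → ℕ → Family k m → Set
Regular t A = ∀ x → ∣ indicesContaining A x ∣ ≡ t

indicesContaining-⊕ˡ : ∀ {k m n} (A : Family k m) (B : Family k n) x →
                       indicesContaining (A ⊕ B) (x ↑ˡ n) ≡ indicesContaining A x
indicesContaining-⊕ˡ A B x = tabulate-cong (λ i → ∈?-++ˡ (A i) (B i) x)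

indicesContaining-⊕ʳ : ∀ {k m n} (A : Family k m) (B : Family k n) x →
                       indicesContaining (A ⊕ B) (m ↑ʳ x) ≡ indicesContaining B x
indicesContaining-⊕ʳ A B x = tabulate-cong (λ i → ∈?-++ʳ (A i) (B i) x)

⊕-regular : ∀ {k m n t} (A : Family k m) (B : Family k n) → Regular t A → Regular t B → Regular t (A ⊕ B)
⊕-regular A B regA regB = ↑-elim
  (λ x → trans (cong ∣_∣ (indicesContaining-⊕ˡ A B x)) (regA x))
  (λ x → trans (cong ∣_∣ (indicesContaining-⊕ʳ A B x)) (regB x))

copies-regular : ∀ {k m t} c (A : Family k m) → Regular t A → Regular t (copies c A)
copies-regular zero    A _   ()
copies-regular (suc c) A reg = ⊕-regular A (copies c A) reg (copies-regular c A reg)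

interOf-cong : ∀ {k m r} (A : Family k m) {i j : Fin r → Fin k} → i ≗ j → interOf A i ≡ interOf A j
interOf-cong A i≗j = cong ⋂ (List.tabulate-cong (cong A ∘ i≗j))

interOf-⊕ : ∀ {k m n r} (A : Family k m) (B : Family k n) (i : Fin r → Fin k) →
            interOf (A ⊕ B) i ≡ interOf A i ++ interOf B i
interOf-⊕ {m = m} {n} {zero}  A B i = sym (⊤++⊤≡⊤ m n)
interOf-⊕         {r = suc r} A B i = begin
  (A (i zero) ++ B (i zero)) ∩ interOf (A ⊕ B) (i ∘ suc)
    ≡⟨ cong ((A (i zero) ++ B (i zero)) ∩_) (interOf-⊕ A B (i ∘ suc)) ⟩
  (A (i zero) ++ B (i zero)) ∩ (interOf A (i ∘ suc) ++ interOf B (i ∘ suc))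
    ≡⟨ zipWith-++ _∧_ (A (i zero)) (B (i zero)) _ _ ⟩
  interOf A i ++ interOf B i
    ∎

∣interOf-⊕∣ : ∀ {k m n r} (A : Family k m) (B : Family k n) (i : Fin r → Fin k) →
              ∣ interOf (A ⊕ B) i ∣ ≡ ∣ interOf A i ∣ + ∣ interOf B i ∣
∣interOf-⊕∣ A B i = trans (cong ∣_∣ (interOf-⊕ A B i)) (∣p++q∣≡∣p∣+∣q∣ (interOf A i) (interOf B i))

∣interOf-copies∣ : ∀ {k m r} c (A : Family k m) (i : Fin r → Fin k) →
                   ∣ interOf (copies c A) i ∣ ≡ c * ∣ interOf A i ∣
∣interOf-copies∣ zero    A i = n≤0⇒n≡0 (∣p∣≤n (interOf (copies zero A) i))
∣interOf-copies∣ (suc c) A i =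
  trans (∣interOf-⊕∣ A (copies c A) i) (cong (∣ interOf A i ∣ +_) (∣interOf-copies∣ c A i))

StrictlyIncreasing : ∀ {r k} → (Fin r → Fin k) → Set
StrictlyIncreasing i = ∀ a b → a <ᶠ b → i a <ᶠ i b

strictlyIncreasing⇒injective : ∀ {r k} {i : Fin r → Fin k} → StrictlyIncreasing i → Injective _≡_ _≡_ i
strictlyIncreasing⇒injective inc {a} {b} ia≡ib with <ᶠ-cmp a b
... | tri< a<b _ _ = contradiction ia≡ib (<ᶠ⇒≢ (inc a b a<b))
... | tri≈ _ a≡b _ = a≡b
... | tri> _ _ b<a = contradiction (sym ia≡ib) (<ᶠ⇒≢ (inc b a b<a))

strictlyIncreasing⇒≤ : ∀ {r k} {i : Fin r → Fin k} → StrictlyIncreasing i → r ≤ k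
strictlyIncreasing⇒≤ inc = injective⇒≤ (strictlyIncreasing⇒injective inc)

avoiding-zero⇒suc : ∀ {r k} (i : Fin r → Fin (suc k)) → (∀ j → zero {k} <ᶠ i j) →
                    Σ[ i′ ∈ (Fin r → Fin k) ] i ≗ suc ∘ i′
avoiding-zero⇒suc i 0<i = (λ j → punchOut (<ᶠ⇒≢ (0<i j))) , (λ j → sym (punchIn-punchOut (<ᶠ⇒≢ (0<i j))))

suc-cancel-increasing : ∀ {r k} {i : Fin r → Fin (suc k)} {i′ : Fin r → Fin k} →
                        i ≗ suc ∘ i′ → StrictlyIncreasing i → StrictlyIncreasing i′
suc-cancel-increasing i≗ inc a b a<b = s<s⁻¹ (subst₂ _<ᶠ_ (i≗ a) (i≗ b) (inc a b a<b))

increasing-from-positive : ∀ {r k} {i : Fin (suc r) → Fin (suc k)} → StrictlyIncreasing i →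
                           zero {k} <ᶠ i zero → ∀ j → zero {k} <ᶠ i j
increasing-from-positive inc 0<i₀ zero    = 0<i₀
increasing-from-positive inc 0<i₀ (suc j) = <-trans 0<i₀ (inc zero (suc j) z<s)

increasing-split : ∀ {r k} (i : Fin (suc r) → Fin (suc k)) → StrictlyIncreasing i →
  (Σ[ i′ ∈ (Fin r → Fin k) ] StrictlyIncreasing i′ × i ≗ zero ∷ᶠ suc ∘ i′) ⊎
  (Σ[ i′ ∈ (Fin (suc r) → Fin k) ] StrictlyIncreasing i′ × i ≗ suc ∘ i′)
increasing-split {k = k} i inc with i zero in i₀
... | zero
  with i′ , i∘suc≗ ← avoiding-zero⇒suc (i ∘ suc) (λ j → subst (_<ᶠ i (suc j)) i₀ (inc zero (suc j) z<s))
  = inj₁ (i′ , suc-cancel-increasing i∘suc≗ (λ a b → inc (suc a) (suc b) ∘ s≤s)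
              , λ { zero → i₀ ; (suc j) → i∘suc≗ j })
... | suc _
  with i′ , i≗ ← avoiding-zero⇒suc i (increasing-from-positive inc (subst (zero {k} <ᶠ_) (sym i₀) z<s))
  = inj₂ (i′ , suc-cancel-increasing i≗ inc , i≗)

-- The points are the k-subsets of {0,…,n-1}, listed by Pascal's rule: first those avoiding 0, then
-- those containing it; the i-th set of the family consists of the points containing i.
incidence : ∀ n k → Family n (binomial n k)
incidence n       zero    = λ _ → ⊥
incidence zero    (suc k) = λ ()
incidence (suc n) (suc k) =
  (⊥ {binomial n (suc k)} ++ ⊤ {binomial n k}) ∷ᶠ (incidence n (suc k) ⊕ incidence n k)

incidence-regular : ∀ n k → Regular k (incidence n k)
incidence-regular n       zero    zero = ∣tabulate-outside∣ n
incidence-regular (suc n) (suc k)      = ↑-elim avoiding0 containing0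
  where
  B = incidence n (suc k)
  C = incidence n k
  ⊥⁺ = ⊥ {binomial n (suc k)}
  ⊤⁺ = ⊤ {binomial n k}
  avoiding0 : ∀ x → ∣ indicesContaining (incidence (suc n) (suc k)) (x ↑ˡ binomial n k) ∣ ≡ suc k
  avoiding0 x = begin
    ∣ does (x ↑ˡ _ ∈? ⊥⁺ ++ ⊤⁺) ∷ indicesContaining (B ⊕ C) (x ↑ˡ _) ∣
      ≡⟨ cong₂ (λ b v → ∣ b ∷ v ∣) 0∉x (indicesContaining-⊕ˡ B C x) ⟩
    ∣ indicesContaining B x ∣
      ≡⟨ incidence-regular n (suc k) x ⟩
    suc k ∎
    where 0∉x = trans (∈?-++ˡ ⊥⁺ ⊤⁺ x) (dec-false (x ∈? ⊥) ∉⊥)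
  containing0 : ∀ x → ∣ indicesContaining (incidence (suc n) (suc k)) (binomial n (suc k) ↑ʳ x) ∣ ≡ suc k
  containing0 x = begin
    ∣ does (_ ↑ʳ x ∈? ⊥⁺ ++ ⊤⁺) ∷ indicesContaining (B ⊕ C) (_ ↑ʳ x) ∣
      ≡⟨ cong₂ (λ b v → ∣ b ∷ v ∣) 0∈x (indicesContaining-⊕ʳ B C x) ⟩
    suc ∣ indicesContaining C x ∣
      ≡⟨ cong suc (incidence-regular n k x) ⟩
    suc k ∎
    where 0∈x = trans (∈?-++ʳ ⊥⁺ ⊤⁺ x) (dec-true (x ∈? ⊤) ∈⊤)

incidence-interOf : ∀ n k r (i : Fin r → Fin n) → StrictlyIncreasing i →
                    ∣ interOf (incidence n k) i ∣ ≡ supersets n k r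
incidence-interOf n       k       zero    i _ = ∣⊤∣≡n (binomial n k)
incidence-interOf zero    k       (suc r) i _ with () ← i zero
incidence-interOf (suc n) zero    (suc r) i _ = cong ∣_∣ (∩-zeroˡ (interOf (incidence (suc n) zero) (i ∘ suc)))
incidence-interOf (suc n) (suc k) (suc r) i inc with increasing-split i inc
... | inj₁ (i′ , inc′ , i≗) = begin
  ∣ interOf A i ∣                                  ≡⟨ cong ∣_∣ (interOf-cong A i≗) ⟩
  ∣ (⊥⁺ ++ ⊤⁺) ∩ interOf (B ⊕ C) i′ ∣               ≡⟨ cong (λ s → ∣ (⊥⁺ ++ ⊤⁺) ∩ s ∣) (interOf-⊕ B C i′) ⟩
  ∣ (⊥⁺ ++ ⊤⁺) ∩ (interOf B i′ ++ interOf C i′) ∣   ≡⟨ ∣[⊥++⊤]∩[p++q]∣≡∣q∣ (interOf B i′) (interOf C i′) ⟩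
  ∣ interOf C i′ ∣                                  ≡⟨ incidence-interOf n k r i′ inc′ ⟩
  supersets n k r                                   ∎
  where
  A = incidence (suc n) (suc k)
  B = incidence n (suc k)
  C = incidence n k
  ⊥⁺ = ⊥ {binomial n (suc k)}
  ⊤⁺ = ⊤ {binomial n k}
... | inj₂ (i′ , inc′ , i≗) = begin
  ∣ interOf A i ∣
    ≡⟨ cong ∣_∣ (interOf-cong A i≗) ⟩
  ∣ interOf (B ⊕ C) i′ ∣
    ≡⟨ ∣interOf-⊕∣ B C i′ ⟩
  ∣ interOf B i′ ∣ + ∣ interOf C i′ ∣
    ≡⟨ cong₂ _+_ (incidence-interOf n (suc k) (suc r) i′ inc′) (incidence-interOf n k (suc r) i′ inc′) ⟩
  supersets n (suc k) (suc r) + supersets n k (suc r)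
    ≡⟨ supersets-pascal n k (suc r) (strictlyIncreasing⇒≤ inc′) ⟩
  supersets (suc n) (suc k) (suc r)
    ∎
  where
  A = incidence (suc n) (suc k)
  B = incidence n (suc k)
  C = incidence n k

incidence-size : ∀ n k i → ∣ incidence (suc n) (suc k) i ∣ ≡ binomial n k
incidence-size n k i = begin
  ∣ A i ∣                            ≡⟨ cong ∣_∣ (∩-identityʳ (A i)) ⟨
  ∣ interOf A (λ (_ : Fin 1) → i) ∣  ≡⟨ incidence-interOf (suc n) (suc k) 1 (λ _ → i) (λ { zero zero () }) ⟩
  binomial n k                       ∎
  where A = incidence (suc n) (suc k)

incidence-interOf*P : ∀ n k s (i : Fin (suc s) → Fin (suc n)) → StrictlyIncreasing i → s ≤ k → k ≤ n →
                      ∣ interOf (incidence (suc n) (suc k)) i ∣ * (n P s) ≡ binomial n k * (k P s)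
incidence-interOf*P n k s i inc s≤k k≤n = begin
  ∣ interOf (incidence (suc n) (suc k)) i ∣ * (n P s)
    ≡⟨ cong₂ _*_ (incidence-interOf (suc n) (suc k) (suc s) i inc) (P≡P′ (≤-trans s≤k k≤n)) ⟩
  supersets n k s * (n P′ s)  ≡⟨ supersets*P′ n k s s≤k k≤n ⟩
  binomial n k * (k P′ s)     ≡⟨ cong (binomial n k *_) (P≡P′ s≤k) ⟨
  binomial n k * (k P s)      ∎

IsDesign : ∀ {k m} → ℕ → ℕ → Family k m → Set
IsDesign {k} d t A =
  ((i : Fin k) → ∣ A i ∣ ≡ d) × Regular t A ×
  ((r : ℕ) → 2 ≤ r → r ≤ t → (i : Fin r → Fin k) → StrictlyIncreasing i →
   ∣ interOf A i ∣ * ((k ∸ 1) P (r ∸ 1)) ≡ d * ((t ∸ 1) P (r ∸ 1)))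

copies-incidence-isDesign : ∀ c n k → k ≤ n →
                            IsDesign (c * binomial n k) (suc k) (copies c (incidence (suc n) (suc k)))
copies-incidence-isDesign c n k k≤n =
  sizes , copies-regular c I (incidence-regular (suc n) (suc k)) , intersections
  where
  I = incidence (suc n) (suc k)
  sizes : ∀ i → ∣ copies c I i ∣ ≡ c * binomial n k
  sizes i = trans (∣copies∣ c I i) (cong (c *_) (incidence-size n k i))
  intersections : ∀ r → 2 ≤ r → r ≤ suc k → (i : Fin r → Fin (suc n)) → StrictlyIncreasing i →
                  ∣ interOf (copies c I) i ∣ * (n P (r ∸ 1)) ≡ c * binomial n k * (k P (r ∸ 1))
  intersections (suc s) _ (s≤s s≤k) i inc = begin
    ∣ interOf (copies c I) i ∣ * (n P s)  ≡⟨ cong (_* (n P s)) (∣interOf-copies∣ c I i) ⟩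
    c * ∣ interOf I i ∣ * (n P s)         ≡⟨ *-assoc c _ _ ⟩
    c * (∣ interOf I i ∣ * (n P s))       ≡⟨ cong (c *_) (incidence-interOf*P n k s i inc s≤k k≤n) ⟩
    c * (binomial n k * (k P s))          ≡⟨ *-assoc c _ _ ⟨
    c * binomial n k * (k P s)            ∎

lemma2 : (k t : ℕ) → 1 ≤ t → t < k →
    (N : ℕ) → ∃ λ d → N < d × 1 ≤ d × t ∣ d * k ×
      ((m : ℕ) → m * t ≡ d * k →
        Σ (Family k m) λ A →
          ((i : Fin k) → ∣ A i ∣ ≡ d) ×
          ((x : Fin m) → ∣ indicesContaining A x ∣ ≡ t) ×
          ((r : ℕ) → 2 ≤ r → r ≤ t → (i : Fin r → Fin k) →
            (∀ a b → a <ᶠ b → i a <ᶠ i b) →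
            ∣ interOf A i ∣ * ((k ∸ 1) P (r ∸ 1)) ≡ d * ((t ∸ 1) P (r ∸ 1))))
lemma2 k@(suc k-1) t@(suc t-1) _ (s≤s t<k) N = d , c≤d , ≤-trans (s≤s z≤n) c≤d , divides M dk≡Mt , design
  where
  c = suc N
  d = c * binomial k-1 t-1
  M = c * binomial k t
  t-1≤k-1 = <⇒≤ t<k
  c≤d : c ≤ d
  c≤d = m≤m*n c (binomial k-1 t-1) {{>-nonZero (k≤n⇒binomial>0 t-1≤k-1)}}
  dk≡Mt : d * k ≡ M * t
  dk≡Mt = begin
    c * binomial k-1 t-1 * k    ≡⟨ *-assoc c (binomial k-1 t-1) k ⟩
    c * (binomial k-1 t-1 * k)  ≡⟨ cong (c *_) (*-comm (binomial k-1 t-1) k) ⟩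
    c * (k * binomial k-1 t-1)  ≡⟨ cong (c *_) (binomial-absorption k-1 t-1) ⟨
    c * (binomial k t * t)      ≡⟨ *-assoc c (binomial k t) t ⟨
    M * t                       ∎
  design : ∀ m → m * t ≡ d * k → Σ (Family k m) (IsDesign d t)
  design m mt≡dk with *-cancelʳ-≡ m M t (trans mt≡dk dk≡Mt)
  ... | refl = copies c (incidence k t) , copies-incidence-isDesign c k-1 t-1 t-1≤k-1
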